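{- Let $s\ge 2$ and $n_1,\ldots,n_s\ge 1$ be integers, $n=n_1+\cdots+n_s$, and let $K_{n_1,\ldots,n_s}$ be the complete $s$-partite graph with partition sets $X_1,\ldots,X_s$, $|X_i|=n_i$. Let $F$ be a spanning forest of $K_{n_1,\ldots,n_s}$ with components $T_1,\ldots,T_c$, and put $n_{ip}=|X_i\cap V(T_p)|$, $m_p=|V(T_p)|$, $\alpha_p=nm_p-\sum_{i=1}^s n_in_{ip}$. Let $Z(0)$ be the $s\times s$ matrix with $(i,j)$ entry $\delta_{ij}-\sum_{p=1}^c\frac{n_{jp}(m_p-n_{ip})}{\alpha_p}$. Then $\operatorname{rank}Z(0)=s-1$.
   Context: $\delta_{ij}$ is the Kronecker delta. -}

module Defs where

open import Data.Nat as ℕ using (ℕ; zero; suc; _∸_)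
open import Data.Fin using (Fin; zero; suc; _≟_)
open import Data.Product using (Σ; ∃; _×_; _,_; proj₁)
open import Data.List using (List; _∷_; []; length; _∷ʳ_)
open import Data.List.Relation.Unary.Linked using (Linked)
open import Data.List.Relation.Unary.Unique.Propositional using (Unique)
open import Data.Integer as ℤ using (ℤ; +_)
open import Data.Rational as ℚ using (ℚ)
open import Data.Empty using (⊥)
open import Relation.Nullary using (¬_; yes; no)
open import Relation.Binary.PropositionalEquality using (_≡_; _≢_)
open import Relation.Binary.Construct.Closure.ReflexiveTransitive using (Star)
open import Function.Bundles using (_⇔_)

sumℕ : ∀ {m} → (Fin m → ℕ) → ℕ
sumℕ {zero} f = 0
sumℕ {suc m} f = f zero ℕ.+ sumℕ (λ k → f (suc k))

sumℚ : ∀ {m} → (Fin m → ℚ) → ℚ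
sumℚ {zero} f = ℚ.0ℚ
sumℚ {suc m} f = f zero ℚ.+ sumℚ (λ k → f (suc k))

-- vertex set of K_{n_1,...,n_s}: X_i = {i} × Fin (n_i)
Vertex : (s : ℕ) → (Fin s → ℕ) → Set
Vertex s ns = Σ (Fin s) (λ i → Fin (ns i))

KAdj : ∀ {s ns} → Vertex s ns → Vertex s ns → Set
KAdj u v = proj₁ u ≢ proj₁ v

-- a graph (symmetric adjacency relation) has no cycle:
-- no list of ≥ 3 distinct vertices x, v_1, ..., v_k with consecutive ones adjacent and v_k adjacent to x
Acyclic : ∀ {V : Set} → (V → V → Set) → Set
Acyclic {V} E = (x : V) (xs : List V) → 2 ℕ.≤ length xs → Unique (x ∷ xs) →
                Linked E ((x ∷ xs) ∷ʳ x) → ⊥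

IsSpanningForest : ∀ s ns → (Vertex s ns → Vertex s ns → Set) → Set
IsSpanningForest s ns F =
  (∀ u v → F u v → KAdj u v) × (∀ u v → F u v → F v u) × Acyclic F

-- comp : V → Fin c enumerates the components T_1, ..., T_c of F:
-- every label is used, and two vertices get the same label iff they are connected in F
IsComponentLabelling : ∀ {V : Set} → (V → V → Set) → (c : ℕ) → (V → Fin c) → Set
IsComponentLabelling {V} F c comp =
  (∀ p → ∃ λ v → comp v ≡ p) × (∀ u v → (comp u ≡ comp v) ⇔ Star F u v)

nip : ∀ {s} (ns : Fin s → ℕ) {c} → (Vertex s ns → Fin c) → Fin s → Fin c → ℕ
nip ns comp i p = sumℕ (λ k → indicator (comp (i , k) ≟ p))
  where
  indicator : ∀ {A : Set} → Relation.Nullary.Dec A → ℕ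
  indicator (yes _) = 1
  indicator (no _) = 0

mp : ∀ {s} (ns : Fin s → ℕ) {c} → (Vertex s ns → Fin c) → Fin c → ℕ
mp ns comp p = sumℕ (λ i → nip ns comp i p)

-- α_p = n m_p − Σ_i n_i n_{ip}  (always ≥ 0, so truncated subtraction is exact)
αp : ∀ {s} (ns : Fin s → ℕ) {c} → (Vertex s ns → Fin c) → Fin c → ℕ
αp ns comp p = sumℕ ns ℕ.* mp ns comp p ∸ sumℕ (λ i → ns i ℕ.* nip ns comp i p)

-- a / d in ℚ for a natural denominator d (d = 0 never occurs here since α_p > 0)
divℕ : ℕ → ℕ → ℚ
divℕ a zero = ℚ.0ℚ
divℕ a (suc d) = (+ a) ℚ./ suc d

δ : ∀ {s} → Fin s → Fin s → ℚ
δ i j with i ≟ j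
... | yes _ = ℚ.1ℚ
... | no _ = ℚ.0ℚ

Z0 : ∀ {s} (ns : Fin s → ℕ) {c} → (Vertex s ns → Fin c) → Fin s → Fin s → ℚ
Z0 ns {c} comp i j =
  δ i j ℚ.- sumℚ {c} (λ p → divℕ (nip ns comp j p ℕ.* (mp ns comp p ∸ nip ns comp i p))
                                  (αp ns comp p))

ColumnsIndependent : ∀ {m s r} → (Fin m → Fin s → ℚ) → (Fin r → Fin s) → Set
ColumnsIndependent {m} {s} {r} M f =
  (a : Fin r → ℚ) → (∀ i → sumℚ (λ k → a k ℚ.* M i (f k)) ≡ ℚ.0ℚ) → ∀ k → a k ≡ ℚ.0ℚ

InjectiveFin : ∀ {r s} → (Fin r → Fin s) → Set
InjectiveFin f = ∀ k l → f k ≡ f l → k ≡ l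

HasRank : ∀ {m s} → (Fin m → Fin s → ℚ) → ℕ → Set
HasRank {m} {s} M r =
  (∃ λ (f : Fin r → Fin s) → InjectiveFin f × ColumnsIndependent M f) ×
  (∀ (g : Fin (suc r) → Fin s) → InjectiveFin g → ¬ ColumnsIndependent M g)

{-# OPTIONS --safe #-}
module Submission where

-- Write Z(0) = I − A, where A i j = Σ_p n_jp (m_p − n_ip) / α_p.  The vector x_i = n − n_i is
-- positive and fixed by A, because Σ_j x_j n_jp = α_p (positive, as every tree is nonempty) and
-- Σ_p (m_p − n_ip) = n − n_i; so x is a relation between the columns of Z(0).  Off the diagonal
-- A is positive: a vertex of X_j lies in a tree T_p with n_jp ≥ 1 and m_p − n_ip ≥ n_jp.  Hence
-- for any y fixed by A the ratios y_j / x_j satisfy a discrete maximum principle and are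
-- constant, so a fixed vector with y_1 = 0 vanishes, i.e. the columns 2, …, s are independent.

open import Defs

open import Algebra.Bundles using (CommutativeRing)
open import Data.Fin as Fin using (Fin; zero; suc; _≟_; punchOut)
import Data.Fin.Properties as FinP
open import Data.Fin.Permutation using (permutation)
import Data.Integer as ℤ
import Data.Integer.Properties as ℤP
open import Data.List using (allFin)
import Data.List.Relation.Unary.All as All
open import Data.List.Membership.Propositional.Properties using (∈-allFin)
open import Data.Nat as ℕ using (ℕ; zero; suc; _≤_; _∸_; z≤n)
import Data.Nat.Properties as ℕP
open import Data.Product using (∃; _,_; proj₁; proj₂)
open import Data.Rational as ℚ using (ℚ; 0ℚ; 1ℚ; _+_; _*_; _-_; toℚᵘ)
import Data.Rational.Properties as ℚP
open import Data.Rational.Solver using (module +-*-Solver)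
import Data.Rational.Unnormalised as ℚᵘ
import Data.Rational.Unnormalised.Properties as ℚᵘP
open import Data.Vec.Functional using (_∷_)
open import Function using (_∘_; _⇔_; mk⇔; Equivalence)
open import Relation.Binary.Bundles using (DecTotalOrder)
open import Relation.Binary.PropositionalEquality
open import Relation.Nullary using (¬_; yes; no; contradiction)

open import Algebra.Properties.Group ℚP.+-0-group using (x∙y⁻¹≈ε⇒x≈y)
open import Algebra.Properties.Semiring.Sum (CommutativeRing.semiring ℚP.+-*-commutativeRing)
  using (sum; ∑-comm; sum-permute)
open import Data.List.Extrema (DecTotalOrder.totalOrder ℚP.≤-decTotalOrder)
  using (argmax; f[xs]≤f[argmax])

-- Opaque so that toℚ (sumℕ f) and toℚ (nip …) are compared argumentwise by unification
-- rather than through the gcd normalisation (see N≡sumℚ-δ).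
opaque
  toℚ : ℕ → ℚ
  toℚ n = ℤ.+ n ℚ./ 1

  toℚ-0 : toℚ 0 ≡ 0ℚ
  toℚ-0 = refl

  toℚ-1 : toℚ 1 ≡ 1ℚ
  toℚ-1 = refl

  toℚᵘ-toℚ : ∀ n → toℚᵘ (toℚ n) ℚᵘ.≃ ℚᵘ.mkℚᵘ (ℤ.+ n) 0
  toℚᵘ-toℚ n = ℚP.toℚᵘ-fromℚᵘ (ℚᵘ.mkℚᵘ (ℤ.+ n) 0)

  toℚᵘ-divℕ : ∀ k d → toℚᵘ (divℕ k (suc d)) ℚᵘ.≃ ℚᵘ.mkℚᵘ (ℤ.+ k) d
  toℚᵘ-divℕ k d = ℚP.toℚᵘ-fromℚᵘ (ℚᵘ.mkℚᵘ (ℤ.+ k) d)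

  toℚ-+ : ∀ m n → toℚ (m ℕ.+ n) ≡ toℚ m + toℚ n
  toℚ-+ m n = ℚP.toℚᵘ-injective (begin
    toℚᵘ (toℚ (m ℕ.+ n))                       ≈⟨ toℚᵘ-toℚ (m ℕ.+ n) ⟩
    ℚᵘ.mkℚᵘ (ℤ.+ (m ℕ.+ n)) 0                  ≈⟨ ℚᵘP.≃-reflexive (cong (λ k → ℚᵘ.mkℚᵘ k 0) numerators) ⟩
    ℚᵘ.mkℚᵘ (ℤ.+ m) 0 ℚᵘ.+ ℚᵘ.mkℚᵘ (ℤ.+ n) 0  ≈⟨ ℚᵘP.+-cong (toℚᵘ-toℚ m) (toℚᵘ-toℚ n) ⟨
    toℚᵘ (toℚ m) ℚᵘ.+ toℚᵘ (toℚ n)             ≈⟨ ℚP.toℚᵘ-homo-+ (toℚ m) (toℚ n) ⟨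
    toℚᵘ (toℚ m + toℚ n)                       ∎)
    where
    open ℚᵘP.≃-Reasoning
    numerators : ℤ.+ (m ℕ.+ n) ≡ ℤ.+ m ℤ.* ℤ.+ 1 ℤ.+ ℤ.+ n ℤ.* ℤ.+ 1
    numerators = trans (ℤP.pos-+ m n)
                       (sym (cong₂ ℤ._+_ (ℤP.*-identityʳ (ℤ.+ m)) (ℤP.*-identityʳ (ℤ.+ n))))

  toℚ-* : ∀ m n → toℚ (m ℕ.* n) ≡ toℚ m * toℚ n
  toℚ-* m n = ℚP.toℚᵘ-injective (begin
    toℚᵘ (toℚ (m ℕ.* n))                       ≈⟨ toℚᵘ-toℚ (m ℕ.* n) ⟩
    ℚᵘ.mkℚᵘ (ℤ.+ (m ℕ.* n)) 0                  ≈⟨ ℚᵘP.≃-reflexive (cong (λ k → ℚᵘ.mkℚᵘ k 0) (ℤP.pos-* m n)) ⟩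
    ℚᵘ.mkℚᵘ (ℤ.+ m) 0 ℚᵘ.* ℚᵘ.mkℚᵘ (ℤ.+ n) 0  ≈⟨ ℚᵘP.*-cong (toℚᵘ-toℚ m) (toℚᵘ-toℚ n) ⟨
    toℚᵘ (toℚ m) ℚᵘ.* toℚᵘ (toℚ n)             ≈⟨ ℚP.toℚᵘ-homo-* (toℚ m) (toℚ n) ⟨
    toℚᵘ (toℚ m * toℚ n)                       ∎)
    where open ℚᵘP.≃-Reasoning

  toℚ-nonneg : ∀ n → 0ℚ ℚ.≤ toℚ n
  toℚ-nonneg n = ℚP.nonNegative⁻¹ (toℚ n) {{ℚP.normalize-nonNeg n 1}}

  toℚ-pos : ∀ {n} → 0 ℕ.< n → 0ℚ ℚ.< toℚ n
  toℚ-pos {suc n} _ = ℚP.positive⁻¹ (toℚ (suc n)) {{ℚP.normalize-pos (suc n) 1}}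

  divℕ≡toℚ*divℕ1 : ∀ k d → divℕ k d ≡ toℚ k * divℕ 1 d
  divℕ≡toℚ*divℕ1 k zero = sym (ℚP.*-zeroʳ (toℚ k))
  divℕ≡toℚ*divℕ1 k (suc d) = ℚP.toℚᵘ-injective (begin
    toℚᵘ (divℕ k (suc d))                      ≈⟨ toℚᵘ-divℕ k d ⟩
    ℚᵘ.mkℚᵘ (ℤ.+ k) d                          ≈⟨ ℚᵘ.*≡* cross ⟩
    ℚᵘ.mkℚᵘ (ℤ.+ k) 0 ℚᵘ.* ℚᵘ.mkℚᵘ (ℤ.+ 1) d  ≈⟨ ℚᵘP.*-cong (toℚᵘ-toℚ k) (toℚᵘ-divℕ 1 d) ⟨
    toℚᵘ (toℚ k) ℚᵘ.* toℚᵘ (divℕ 1 (suc d))    ≈⟨ ℚP.toℚᵘ-homo-* (toℚ k) (divℕ 1 (suc d)) ⟨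
    toℚᵘ (toℚ k * divℕ 1 (suc d))              ∎)
    where
    open ℚᵘP.≃-Reasoning
    cross : ℤ.+ k ℤ.* ℤ.+ suc (d ℕ.+ 0) ≡ (ℤ.+ k ℤ.* ℤ.+ 1) ℤ.* ℤ.+ suc d
    cross = cong₂ ℤ._*_ (sym (ℤP.*-identityʳ (ℤ.+ k)))
                        (cong (λ e → ℤ.+ suc e) (ℕP.+-identityʳ d))

  divℕ1*toℚ≡1 : ∀ {d} → 0 ℕ.< d → divℕ 1 d * toℚ d ≡ 1ℚ
  divℕ1*toℚ≡1 {suc d} _ = ℚP.toℚᵘ-injective (begin
    toℚᵘ (divℕ 1 (suc d) * toℚ (suc d))
      ≈⟨ ℚP.toℚᵘ-homo-* (divℕ 1 (suc d)) (toℚ (suc d)) ⟩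
    toℚᵘ (divℕ 1 (suc d)) ℚᵘ.* toℚᵘ (toℚ (suc d))
      ≈⟨ ℚᵘP.*-cong (toℚᵘ-divℕ 1 d) (toℚᵘ-toℚ (suc d)) ⟩
    ℚᵘ.mkℚᵘ (ℤ.+ 1) d ℚᵘ.* ℚᵘ.mkℚᵘ (ℤ.+ suc d) 0
      ≈⟨ ℚᵘ.*≡* cross ⟩
    ℚᵘ.1ℚᵘ
      ∎)
    where
    open ℚᵘP.≃-Reasoning
    cross : ℤ.+ suc ((d ℕ.+ 0) ℕ.* 1) ≡ ℤ.+ suc (d ℕ.* 1 ℕ.+ 0)
    cross = cong (λ e → ℤ.+ suc e) (ℕP.*-distribʳ-+ 1 d 0)

toℚ-∸ : ∀ {m n} → n ≤ m → toℚ (m ∸ n) ≡ toℚ m - toℚ n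
toℚ-∸ {m} {n} n≤m = begin
  toℚ (m ∸ n)                  ≡⟨ solve 2 (λ a b → a := b :+ a :- b) refl (toℚ (m ∸ n)) (toℚ n) ⟩
  toℚ n + toℚ (m ∸ n) - toℚ n  ≡⟨ cong (_- toℚ n) (toℚ-+ n (m ∸ n)) ⟨
  toℚ (n ℕ.+ (m ∸ n)) - toℚ n  ≡⟨ cong (λ k → toℚ k - toℚ n) (ℕP.m+[n∸m]≡n n≤m) ⟩
  toℚ m - toℚ n                ∎
  where open ≡-Reasoning; open +-*-Solver

toℚ-pos⁻¹ : ∀ {n} → 0ℚ ℚ.< toℚ n → 0 ℕ.< n
toℚ-pos⁻¹ {zero} 0<0 = contradiction 0<0 (ℚP.<-irrefl (sym toℚ-0))
toℚ-pos⁻¹ {suc n} _ = ℕ.z<s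

divℕ-nonneg : ∀ k d → 0ℚ ℚ.≤ divℕ k d
divℕ-nonneg k zero = ℚP.≤-refl
divℕ-nonneg k (suc d) = ℚP.nonNegative⁻¹ (divℕ k (suc d)) {{ℚP.normalize-nonNeg k (suc d)}}

divℕ1-pos : ∀ {d} → 0 ℕ.< d → 0ℚ ℚ.< divℕ 1 d
divℕ1-pos {suc d} _ = ℚP.positive⁻¹ (divℕ 1 (suc d)) {{ℚP.normalize-pos 1 (suc d)}}

*-nonneg : ∀ {p q} → 0ℚ ℚ.≤ p → 0ℚ ℚ.≤ q → 0ℚ ℚ.≤ p * q
*-nonneg {p} {q} 0≤p 0≤q = ℚP.nonNegative⁻¹ (p * q) {{ℚP.nonNeg*nonNeg⇒nonNeg p q}}
  where instance _ = ℚ.nonNegative 0≤p; _ = ℚ.nonNegative 0≤q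

*-pos : ∀ {p q} → 0ℚ ℚ.< p → 0ℚ ℚ.< q → 0ℚ ℚ.< p * q
*-pos {p} {q} 0<p 0<q = ℚP.positive⁻¹ (p * q) {{ℚP.pos*pos⇒pos p q}}
  where instance _ = ℚ.positive 0<p; _ = ℚ.positive 0<q

pos*q≡0⇒q≡0 : ∀ {p q} → 0ℚ ℚ.< p → p * q ≡ 0ℚ → q ≡ 0ℚ
pos*q≡0⇒q≡0 {p} 0<p pq≡0 = ℚP.≤-antisym
  (ℚP.*-cancelˡ-≤-pos p (ℚP.≤-reflexive (trans pq≡0 (sym (ℚP.*-zeroʳ p)))))
  (ℚP.*-cancelˡ-≤-pos p (ℚP.≤-reflexive (trans (ℚP.*-zeroʳ p) (sym pq≡0))))
  where instance _ = ℚ.positive 0<p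

p≤q⇒0≤q-p : ∀ {p q} → p ℚ.≤ q → 0ℚ ℚ.≤ q - p
p≤q⇒0≤q-p {p} p≤q = ℚP.≤-trans (ℚP.≤-reflexive (sym (ℚP.+-inverseʳ p))) (ℚP.+-monoˡ-≤ (ℚ.- p) p≤q)

p+q≤r⇒q≤r-p : ∀ {p q r} → p + q ℚ.≤ r → q ℚ.≤ r - p
p+q≤r⇒q≤r-p {p} {q} p+q≤r = ℚP.≤-trans
  (ℚP.≤-reflexive (solve 2 (λ p q → q := p :+ q :- p) refl p q))
  (ℚP.+-monoˡ-≤ (ℚ.- p) p+q≤r)
  where open +-*-Solver

δ-diag : ∀ {s} (i : Fin s) → δ i i ≡ 1ℚ
δ-diag i with i ≟ i
... | yes _ = refl
... | no i≢i = contradiction refl i≢i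

δ-offdiag : ∀ {s} {i j : Fin s} → j ≢ i → δ i j ≡ 0ℚ
δ-offdiag {i = i} {j} j≢i with i ≟ j
... | yes i≡j = contradiction (sym i≡j) j≢i
... | no _ = refl

δ-nonneg : ∀ {s} (i j : Fin s) → 0ℚ ℚ.≤ δ i j
δ-nonneg i j with i ≟ j
... | yes _ = ℚP.<⇒≤ (ℚP.positive⁻¹ 1ℚ)
... | no _ = ℚP.≤-refl

sumℚ-cong : ∀ {m} {f g : Fin m → ℚ} → f ≗ g → sumℚ f ≡ sumℚ g
sumℚ-cong {zero} _ = refl
sumℚ-cong {suc m} f≗g = cong₂ _+_ (f≗g zero) (sumℚ-cong (f≗g ∘ suc))

sumℚ≡sum : ∀ {m} (f : Fin m → ℚ) → sumℚ f ≡ sum f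
sumℚ≡sum {zero} f = refl
sumℚ≡sum {suc m} f = cong (f zero +_) (sumℚ≡sum (f ∘ suc))

sumℚ-comm : ∀ {m n} (f : Fin m → Fin n → ℚ) →
            sumℚ (λ i → sumℚ (f i)) ≡ sumℚ (λ j → sumℚ (λ i → f i j))
sumℚ-comm f = trans (sumℚ²≡sum² f) (trans (∑-comm f) (sym (sumℚ²≡sum² (λ j i → f i j))))
  where
  sumℚ²≡sum² : ∀ {m n} (f : Fin m → Fin n → ℚ) → sumℚ (λ i → sumℚ (f i)) ≡ sum (λ i → sum (f i))
  sumℚ²≡sum² f = trans (sumℚ-cong (λ i → sumℚ≡sum (f i))) (sumℚ≡sum (λ i → sum (f i)))

injective⇒surjective : ∀ {n} (g : Fin n → Fin n) → InjectiveFin g → ∀ j → ∃ λ k → g k ≡ j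
injective⇒surjective {suc n} g g-inj j with FinP.any? (λ k → g k ≟ j)
... | yes hit = hit
... | no miss = contradiction (FinP.injective⇒≤ squeeze-injective) ℕP.1+n≰n
  where
  j≢g : ∀ k → j ≢ g k
  j≢g k j≡gk = miss (k , sym j≡gk)
  squeeze : Fin (suc n) → Fin n
  squeeze k = punchOut (j≢g k)
  squeeze-injective : ∀ {k l} → squeeze k ≡ squeeze l → k ≡ l
  squeeze-injective {k} {l} eq = g-inj k l (FinP.punchOut-injective (j≢g k) (j≢g l) eq)

sumℚ-reindex : ∀ {n} (g : Fin n → Fin n) → InjectiveFin g → (f : Fin n → ℚ) → sumℚ (f ∘ g) ≡ sumℚ f
sumℚ-reindex g g-inj f = begin
  sumℚ (f ∘ g)  ≡⟨ sumℚ≡sum (f ∘ g) ⟩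
  sum (f ∘ g)   ≡⟨ sum-permute f (permutation g g⁻¹ (proj₂ ∘ onto) (λ k → g-inj _ k (proj₂ (onto (g k))))) ⟨
  sum f         ≡⟨ sumℚ≡sum f ⟨
  sumℚ f        ∎
  where
  open ≡-Reasoning
  onto : ∀ j → ∃ λ k → g k ≡ j
  onto = injective⇒surjective g g-inj
  g⁻¹ : Fin _ → Fin _
  g⁻¹ = proj₁ ∘ onto

*-distribˡ-sumℚ : ∀ {m} p (f : Fin m → ℚ) → p * sumℚ f ≡ sumℚ (λ k → p * f k)
*-distribˡ-sumℚ {zero} p f = ℚP.*-zeroʳ p
*-distribˡ-sumℚ {suc m} p f =
  trans (ℚP.*-distribˡ-+ p (f zero) _) (cong (p * f zero +_) (*-distribˡ-sumℚ p (f ∘ suc)))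

sumℚ-distrib-- : ∀ {m} (f g : Fin m → ℚ) → sumℚ (λ k → f k - g k) ≡ sumℚ f - sumℚ g
sumℚ-distrib-- {zero} f g = refl
sumℚ-distrib-- {suc m} f g =
  trans (cong (f zero - g zero +_) (sumℚ-distrib-- (f ∘ suc) (g ∘ suc)))
        (solve 4 (λ a b c d → (a :- b) :+ (c :- d) := (a :+ c) :- (b :+ d)) refl
               (f zero) (g zero) (sumℚ (f ∘ suc)) (sumℚ (g ∘ suc)))
  where open +-*-Solver

sumℚ-zero : ∀ m → sumℚ {m} (λ _ → 0ℚ) ≡ 0ℚ
sumℚ-zero zero = refl
sumℚ-zero (suc m) = trans (ℚP.+-identityˡ _) (sumℚ-zero m)

sumℚ-single : ∀ {m} (i : Fin m) (f : Fin m → ℚ) → (∀ j → j ≢ i → f j ≡ 0ℚ) → sumℚ f ≡ f i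
sumℚ-single {suc m} zero f f≡0 = trans
  (cong (f zero +_) (trans (sumℚ-cong (λ j → f≡0 (suc j) λ ())) (sumℚ-zero m)))
  (ℚP.+-identityʳ (f zero))
sumℚ-single (suc i) f f≡0 = trans
  (cong (_+ sumℚ (f ∘ suc)) (f≡0 zero λ ()))
  (trans (ℚP.+-identityˡ _)
         (sumℚ-single i (f ∘ suc) (λ j j≢i → f≡0 (suc j) (j≢i ∘ FinP.suc-injective))))

sumℚ-δ : ∀ {m} (i : Fin m) → sumℚ (δ i) ≡ 1ℚ
sumℚ-δ i = trans (sumℚ-single i (δ i) (λ j → δ-offdiag)) (δ-diag i)

sumℚ-δ* : ∀ {m} (i : Fin m) (y : Fin m → ℚ) → sumℚ (λ j → δ i j * y j) ≡ y i
sumℚ-δ* i y = begin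
  sumℚ (λ j → δ i j * y j)  ≡⟨ sumℚ-single i (λ j → δ i j * y j) off-i ⟩
  δ i i * y i               ≡⟨ cong (_* y i) (δ-diag i) ⟩
  1ℚ * y i                  ≡⟨ ℚP.*-identityˡ (y i) ⟩
  y i                       ∎
  where
  open ≡-Reasoning
  off-i : ∀ j → j ≢ i → δ i j * y j ≡ 0ℚ
  off-i j j≢i = trans (cong (_* y j) (δ-offdiag j≢i)) (ℚP.*-zeroˡ (y j))

toℚ-sumℕ : ∀ {m} (f : Fin m → ℕ) → toℚ (sumℕ f) ≡ sumℚ (toℚ ∘ f)
toℚ-sumℕ {zero} f = toℚ-0
toℚ-sumℕ {suc m} f = trans (toℚ-+ (f zero) _) (cong (toℚ (f zero) +_) (toℚ-sumℕ (f ∘ suc)))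

sumℚ-1 : ∀ m → sumℚ {m} (λ _ → 1ℚ) ≡ toℚ m
sumℚ-1 zero = sym toℚ-0
sumℚ-1 (suc m) = trans (cong₂ _+_ (sym toℚ-1) (sumℚ-1 m)) (sym (toℚ-+ 1 m))

sumℚ-nonneg : ∀ {m} {f : Fin m → ℚ} → (∀ k → 0ℚ ℚ.≤ f k) → 0ℚ ℚ.≤ sumℚ f
sumℚ-nonneg {zero} _ = ℚP.≤-refl
sumℚ-nonneg {suc m} f≥0 = ℚP.+-mono-≤ (f≥0 zero) (sumℚ-nonneg (f≥0 ∘ suc))

≤sumℚ : ∀ {m} {f : Fin m → ℚ} → (∀ k → 0ℚ ℚ.≤ f k) → ∀ k → f k ℚ.≤ sumℚ f
≤sumℚ {suc m} {f} f≥0 zero = ℚP.≤-trans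
  (ℚP.≤-reflexive (sym (ℚP.+-identityʳ (f zero))))
  (ℚP.+-monoʳ-≤ (f zero) (sumℚ-nonneg (f≥0 ∘ suc)))
≤sumℚ {suc m} {f} f≥0 (suc k) = ℚP.≤-trans
  (ℚP.≤-reflexive (sym (ℚP.+-identityˡ (f (suc k)))))
  (ℚP.+-mono-≤ (f≥0 zero) (≤sumℚ (f≥0 ∘ suc) k))

pair≤sumℚ : ∀ {m} {f : Fin m → ℚ} → (∀ k → 0ℚ ℚ.≤ f k) → ∀ {i j} → i ≢ j → f i + f j ℚ.≤ sumℚ f
pair≤sumℚ f≥0 {zero} {zero} i≢j = contradiction refl i≢j
pair≤sumℚ {f = f} f≥0 {zero} {suc j} _ = ℚP.+-monoʳ-≤ (f zero) (≤sumℚ (f≥0 ∘ suc) j)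
pair≤sumℚ {f = f} f≥0 {suc i} {zero} _ = ℚP.≤-trans
  (ℚP.≤-reflexive (ℚP.+-comm (f (suc i)) (f zero)))
  (ℚP.+-monoʳ-≤ (f zero) (≤sumℚ (f≥0 ∘ suc) i))
pair≤sumℚ f≥0 {suc i} {suc j} i≢j = ℚP.≤-trans
  (ℚP.≤-reflexive (sym (ℚP.+-identityˡ _)))
  (ℚP.+-mono-≤ (f≥0 zero) (pair≤sumℚ (f≥0 ∘ suc) (i≢j ∘ cong suc)))

≤sumℚ-minus : ∀ {m} {f : Fin m → ℚ} → (∀ k → 0ℚ ℚ.≤ f k) → ∀ {i j} → i ≢ j → f j ℚ.≤ sumℚ f - f i
≤sumℚ-minus f≥0 i≢j = p+q≤r⇒q≤r-p (pair≤sumℚ f≥0 i≢j)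

sumℚ≡0⇒≡0 : ∀ {m} {f : Fin m → ℚ} → (∀ k → 0ℚ ℚ.≤ f k) → sumℚ f ≡ 0ℚ → ∀ k → f k ≡ 0ℚ
sumℚ≡0⇒≡0 f≥0 Σf≡0 k = ℚP.≤-antisym (ℚP.≤-trans (≤sumℚ f≥0 k) (ℚP.≤-reflexive Σf≡0)) (f≥0 k)

≤sumℕ : ∀ {m} (f : Fin m → ℕ) k → f k ≤ sumℕ f
≤sumℕ f zero = ℕP.m≤m+n (f zero) _
≤sumℕ f (suc k) = ℕP.≤-trans (≤sumℕ (f ∘ suc) k) (ℕP.m≤n+m _ (f zero))

sumℕ-mono-≤ : ∀ {m} {f g : Fin m → ℕ} → (∀ k → f k ≤ g k) → sumℕ f ≤ sumℕ g
sumℕ-mono-≤ {zero} _ = z≤n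
sumℕ-mono-≤ {suc m} f≤g = ℕP.+-mono-≤ (f≤g zero) (sumℕ-mono-≤ (f≤g ∘ suc))

*-distribˡ-sumℕ : ∀ {m} n (f : Fin m → ℕ) → n ℕ.* sumℕ f ≡ sumℕ (λ k → n ℕ.* f k)
*-distribˡ-sumℕ {zero} n f = ℕP.*-zeroʳ n
*-distribˡ-sumℕ {suc m} n f =
  trans (ℕP.*-distribˡ-+ n (f zero) _) (cong (n ℕ.* f zero ℕ.+_) (*-distribˡ-sumℕ n (f ∘ suc)))

infixr 7 _*ᵥ_

_*ᵥ_ : ∀ {m n} → (Fin m → Fin n → ℚ) → (Fin n → ℚ) → Fin m → ℚ
(M *ᵥ y) i = sumℚ (λ j → y j * M i j)

I-_ : ∀ {n} → (Fin n → Fin n → ℚ) → Fin n → Fin n → ℚ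
(I- A) i j = δ i j - A i j

I-*ᵥ : ∀ {n} (A : Fin n → Fin n → ℚ) y i → ((I- A) *ᵥ y) i ≡ y i - (A *ᵥ y) i
I-*ᵥ A y i = begin
  sumℚ (λ j → y j * (δ i j - A i j))      ≡⟨ sumℚ-cong (λ j → expand (y j) (δ i j) (A i j)) ⟩
  sumℚ (λ j → δ i j * y j - y j * A i j)  ≡⟨ sumℚ-distrib-- (λ j → δ i j * y j) (λ j → y j * A i j) ⟩
  sumℚ (λ j → δ i j * y j) - (A *ᵥ y) i   ≡⟨ cong (_- (A *ᵥ y) i) (sumℚ-δ* i y) ⟩
  y i - (A *ᵥ y) i                        ∎
  where
  open ≡-Reasoning
  expand : ∀ y d a → y * (d - a) ≡ d * y - y * a
  expand = solve 3 (λ y d a → y :* (d :- a) := d :* y :- y :* a) refl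
    where open +-*-Solver

kernel-I-⇔fixed : ∀ {n} (A : Fin n → Fin n → ℚ) y i → ((I- A) *ᵥ y) i ≡ 0ℚ ⇔ (A *ᵥ y) i ≡ y i
kernel-I-⇔fixed A y i = mk⇔
  (λ eq → sym (x∙y⁻¹≈ε⇒x≈y (y i) ((A *ᵥ y) i) (trans (sym (I-*ᵥ A y i)) eq)))
  (λ eq → trans (I-*ᵥ A y i) (trans (cong (y i -_) eq) (ℚP.+-inverseʳ (y i))))

maximum-principle : ∀ {n} (B : Fin (suc n) → Fin (suc n) → ℚ) (t : Fin (suc n) → ℚ) →
                    (∀ i j → 0ℚ ℚ.≤ B i j) → (∀ i j → i ≢ j → 0ℚ ℚ.< B i j) →
                    (∀ i → sumℚ (λ j → B i j * (t i - t j)) ≡ 0ℚ) →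
                    ∀ j k → t j ≡ t k
maximum-principle {n} B t B≥0 B>0 balanced j k = trans (t≡tₘ j) (sym (t≡tₘ k))
  where
  m : Fin (suc n)
  m = argmax t zero (allFin (suc n))
  t≤tₘ : ∀ j → t j ℚ.≤ t m
  t≤tₘ j = All.lookup (f[xs]≤f[argmax] {f = t} zero (allFin (suc n))) (∈-allFin j)
  term≥0 : ∀ j → 0ℚ ℚ.≤ B m j * (t m - t j)
  term≥0 j = *-nonneg (B≥0 m j) (p≤q⇒0≤q-p (t≤tₘ j))
  t≡tₘ : ∀ j → t j ≡ t m
  t≡tₘ j with j ≟ m
  ... | yes j≡m = cong t j≡m
  ... | no j≢m = sym (x∙y⁻¹≈ε⇒x≈y (t m) (t j)
                   (pos*q≡0⇒q≡0 (B>0 m j (j≢m ∘ sym)) (sumℚ≡0⇒≡0 term≥0 (balanced m) j)))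

module _ {n} (A : Fin (suc n) → Fin (suc n) → ℚ) (x : Fin (suc n) → ℚ)
         (A≥0 : ∀ i j → 0ℚ ℚ.≤ A i j) (A>0 : ∀ i j → i ≢ j → 0ℚ ℚ.< A i j)
         (x>0 : ∀ j → 0ℚ ℚ.< x j) (A*ᵥx≗x : A *ᵥ x ≗ x) where

  fixed-vector-vanishing : ∀ y → A *ᵥ y ≗ y → y zero ≡ 0ℚ → ∀ j → y j ≡ 0ℚ
  fixed-vector-vanishing y A*ᵥy≗y y₀≡0 j = begin
    y j        ≡⟨ t*x≡y j ⟨
    t j * x j  ≡⟨ cong (_* x j) (trans (t-constant j zero) t₀≡0) ⟩
    0ℚ * x j   ≡⟨ ℚP.*-zeroˡ (x j) ⟩
    0ℚ         ∎
    where
    open ≡-Reasoning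
    instance
      x≢0 : ∀ {j} → ℚ.NonZero (x j)
      x≢0 {j} = ℚP.pos⇒nonZero (x j) {{ℚ.positive (x>0 j)}}
    t : Fin (suc n) → ℚ
    t j = y j * ℚ.1/ x j
    t*x≡y : ∀ j → t j * x j ≡ y j
    t*x≡y j = trans (ℚP.*-assoc (y j) (ℚ.1/ x j) (x j))
                    (trans (cong (y j *_) (ℚP.*-inverseˡ (x j))) (ℚP.*-identityʳ (y j)))
    t₀≡0 : t zero ≡ 0ℚ
    t₀≡0 = trans (cong (_* ℚ.1/ x zero) y₀≡0) (ℚP.*-zeroˡ (ℚ.1/ x zero))
    balanced : ∀ i → sumℚ (λ j → (x j * A i j) * (t i - t j)) ≡ 0ℚ
    balanced i = begin
      sumℚ (λ j → (x j * A i j) * (t i - t j))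
        ≡⟨ sumℚ-cong term ⟩
      sumℚ (λ j → t i * (x j * A i j) - y j * A i j)
        ≡⟨ sumℚ-distrib-- (λ j → t i * (x j * A i j)) (λ j → y j * A i j) ⟩
      sumℚ (λ j → t i * (x j * A i j)) - (A *ᵥ y) i
        ≡⟨ cong₂ _-_ (sym (*-distribˡ-sumℚ (t i) (λ j → x j * A i j))) (A*ᵥy≗y i) ⟩
      t i * (A *ᵥ x) i - y i
        ≡⟨ cong (λ z → t i * z - y i) (A*ᵥx≗x i) ⟩
      t i * x i - y i
        ≡⟨ cong (_- y i) (t*x≡y i) ⟩
      y i - y i
        ≡⟨ ℚP.+-inverseʳ (y i) ⟩
      0ℚ
        ∎
      where
      term : ∀ j → (x j * A i j) * (t i - t j) ≡ t i * (x j * A i j) - y j * A i j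
      term j = trans (expand (x j) (A i j) (t i) (t j))
                     (cong (λ z → t i * (x j * A i j) - z * A i j) (t*x≡y j))
        where
        expand : ∀ x a tᵢ tⱼ → (x * a) * (tᵢ - tⱼ) ≡ tᵢ * (x * a) - (tⱼ * x) * a
        expand = solve 4 (λ x a tᵢ tⱼ → (x :* a) :* (tᵢ :- tⱼ) := tᵢ :* (x :* a) :- (tⱼ :* x) :* a)
                         refl
          where open +-*-Solver
    t-constant : ∀ j k → t j ≡ t k
    t-constant = maximum-principle (λ i j → x j * A i j) t
      (λ i j → *-nonneg (ℚP.<⇒≤ (x>0 j)) (A≥0 i j))
      (λ i j i≢j → *-pos (x>0 j) (A>0 i j i≢j))
      balanced

  hasRank-I- : HasRank (I- A) n
  hasRank-I- = (suc , (λ _ _ → FinP.suc-injective) , tail-columns-independent) , no-full-rank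
    where
    tail-columns-independent : ColumnsIndependent (I- A) suc
    tail-columns-independent a dependent k = fixed-vector-vanishing (0ℚ ∷ a) fixed refl (suc k)
      where
      in-kernel : ∀ i → ((I- A) *ᵥ (0ℚ ∷ a)) i ≡ 0ℚ
      in-kernel i = trans (cong (_+ sumℚ (λ k → a k * (I- A) i (suc k))) (ℚP.*-zeroˡ ((I- A) i zero)))
                          (trans (ℚP.+-identityˡ _) (dependent i))
      fixed : A *ᵥ (0ℚ ∷ a) ≗ 0ℚ ∷ a
      fixed i = Equivalence.to (kernel-I-⇔fixed A (0ℚ ∷ a) i) (in-kernel i)
    no-full-rank : ∀ g → InjectiveFin g → ¬ ColumnsIndependent (I- A) g
    no-full-rank g g-inj independent =
      ℚP.<-irrefl (sym (independent (x ∘ g) x∘g-in-kernel zero)) (x>0 (g zero))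
      where
      x∘g-in-kernel : ∀ i → sumℚ (λ k → x (g k) * (I- A) i (g k)) ≡ 0ℚ
      x∘g-in-kernel i = trans (sumℚ-reindex g g-inj (λ j → x j * (I- A) i j))
                              (Equivalence.from (kernel-I-⇔fixed A x i) (A*ᵥx≗x i))

module Partition {s} (ns : Fin s → ℕ) {c} (comp : Vertex s ns → Fin c) where

  N : Fin s → Fin c → ℚ
  N i p = toℚ (nip ns comp i p)

  M : Fin c → ℚ
  M p = toℚ (mp ns comp p)

  n : ℚ
  n = toℚ (sumℕ ns)

  x : Fin s → ℚ
  x i = n - toℚ (ns i)

  w : Fin c → ℚ
  w p = divℕ 1 (αp ns comp p)

  Aᵖ : Fin c → Fin s → Fin s → ℚ
  Aᵖ p i j = divℕ (nip ns comp j p ℕ.* (mp ns comp p ∸ nip ns comp i p)) (αp ns comp p)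

  -- Z0 ns comp is definitionally I- A.
  A : Fin s → Fin s → ℚ
  A i j = sumℚ (λ p → Aᵖ p i j)

  -- nip sums an indicator that is local to Defs and cannot be named here, so the summand in
  -- toℚ-indicator is left to unification; N≡sumℚ-δ, checked first, determines it.
  mutual
    N≡sumℚ-δ : ∀ i p → N i p ≡ sumℚ (λ k → δ (comp (i , k)) p)
    N≡sumℚ-δ i p = trans (toℚ-sumℕ {ns i} _) (sumℚ-cong (toℚ-indicator i p))

    toℚ-indicator : ∀ i p k → toℚ _ ≡ δ (comp (i , k)) p
    toℚ-indicator i p k with comp (i , k) ≟ p
    ... | yes _ = toℚ-1
    ... | no _ = toℚ-0

  sumℚ-N : ∀ i → sumℚ (N i) ≡ toℚ (ns i)
  sumℚ-N i = begin
    sumℚ (N i)                                    ≡⟨ sumℚ-cong (N≡sumℚ-δ i) ⟩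
    sumℚ (λ p → sumℚ (λ k → δ (comp (i , k)) p))  ≡⟨ sumℚ-comm (λ p k → δ (comp (i , k)) p) ⟩
    sumℚ (λ k → sumℚ (δ (comp (i , k))))          ≡⟨ sumℚ-cong (λ k → sumℚ-δ (comp (i , k))) ⟩
    sumℚ {ns i} (λ _ → 1ℚ)                        ≡⟨ sumℚ-1 (ns i) ⟩
    toℚ (ns i)                                    ∎
    where open ≡-Reasoning

  M≡sumℚ-N : ∀ p → M p ≡ sumℚ (λ i → N i p)
  M≡sumℚ-N p = toℚ-sumℕ (λ i → nip ns comp i p)

  sumℚ-M : sumℚ M ≡ n
  sumℚ-M = begin
    sumℚ M                           ≡⟨ sumℚ-cong M≡sumℚ-N ⟩
    sumℚ (λ p → sumℚ (λ i → N i p))  ≡⟨ sumℚ-comm (λ p i → N i p) ⟩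
    sumℚ (λ i → sumℚ (N i))          ≡⟨ sumℚ-cong sumℚ-N ⟩
    sumℚ (toℚ ∘ ns)                  ≡⟨ toℚ-sumℕ ns ⟨
    n                                ∎
    where open ≡-Reasoning

  nip≤mp : ∀ i p → nip ns comp i p ≤ mp ns comp p
  nip≤mp i p = ≤sumℕ (λ i → nip ns comp i p) i

  weighted-nip≤n*mp : ∀ p → sumℕ (λ i → ns i ℕ.* nip ns comp i p) ≤ sumℕ ns ℕ.* mp ns comp p
  weighted-nip≤n*mp p = ℕP.≤-trans
    (sumℕ-mono-≤ (λ i → ℕP.*-monoˡ-≤ (nip ns comp i p) (≤sumℕ ns i)))
    (ℕP.≤-reflexive (sym (*-distribˡ-sumℕ (sumℕ ns) (λ i → nip ns comp i p))))

  toℚ-α : ∀ p → toℚ (αp ns comp p) ≡ sumℚ (λ j → x j * N j p)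
  toℚ-α p = begin
    toℚ (αp ns comp p)
      ≡⟨ toℚ-∸ (weighted-nip≤n*mp p) ⟩
    toℚ (sumℕ ns ℕ.* mp ns comp p) - toℚ (sumℕ (λ j → ns j ℕ.* nip ns comp j p))
      ≡⟨ cong₂ _-_ (toℚ-* (sumℕ ns) (mp ns comp p))
                   (trans (toℚ-sumℕ (λ j → ns j ℕ.* nip ns comp j p))
                          (sumℚ-cong (λ j → toℚ-* (ns j) (nip ns comp j p)))) ⟩
    n * M p - sumℚ (λ j → toℚ (ns j) * N j p)
      ≡⟨ cong (_- sumℚ (λ j → toℚ (ns j) * N j p))
              (trans (cong (n *_) (M≡sumℚ-N p)) (*-distribˡ-sumℚ n (λ j → N j p))) ⟩
    sumℚ (λ j → n * N j p) - sumℚ (λ j → toℚ (ns j) * N j p)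
      ≡⟨ sumℚ-distrib-- (λ j → n * N j p) (λ j → toℚ (ns j) * N j p) ⟨
    sumℚ (λ j → n * N j p - toℚ (ns j) * N j p)
      ≡⟨ sumℚ-cong (λ j → distrib n (toℚ (ns j)) (N j p)) ⟨
    sumℚ (λ j → x j * N j p)
      ∎
    where
    open ≡-Reasoning
    distrib : ∀ a b c → (a - b) * c ≡ a * c - b * c
    distrib = solve 3 (λ a b c → (a :- b) :* c := a :* c :- b :* c) refl
      where open +-*-Solver

  Aᵖ≡N*[M-N]*w : ∀ p i j → Aᵖ p i j ≡ N j p * (M p - N i p) * w p
  Aᵖ≡N*[M-N]*w p i j = begin
    Aᵖ p i j
      ≡⟨ divℕ≡toℚ*divℕ1 (nip ns comp j p ℕ.* (mp ns comp p ∸ nip ns comp i p)) (αp ns comp p) ⟩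
    toℚ (nip ns comp j p ℕ.* (mp ns comp p ∸ nip ns comp i p)) * w p
      ≡⟨ cong (_* w p) (toℚ-* (nip ns comp j p) (mp ns comp p ∸ nip ns comp i p)) ⟩
    N j p * toℚ (mp ns comp p ∸ nip ns comp i p) * w p
      ≡⟨ cong (λ z → N j p * z * w p) (toℚ-∸ (nip≤mp i p)) ⟩
    N j p * (M p - N i p) * w p
      ∎
    where open ≡-Reasoning

  x-weighted-Aᵖ : ∀ {p} → 0 ℕ.< αp ns comp p → ∀ i → sumℚ (λ j → x j * Aᵖ p i j) ≡ M p - N i p
  x-weighted-Aᵖ {p} α>0 i = begin
    sumℚ (λ j → x j * Aᵖ p i j)           ≡⟨ sumℚ-cong term ⟩
    sumℚ (λ j → (d * w p) * (x j * N j p)) ≡⟨ *-distribˡ-sumℚ (d * w p) (λ j → x j * N j p) ⟨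
    (d * w p) * sumℚ (λ j → x j * N j p)   ≡⟨ cong ((d * w p) *_) (toℚ-α p) ⟨
    (d * w p) * toℚ (αp ns comp p)         ≡⟨ ℚP.*-assoc d (w p) (toℚ (αp ns comp p)) ⟩
    d * (w p * toℚ (αp ns comp p))         ≡⟨ cong (d *_) (divℕ1*toℚ≡1 α>0) ⟩
    d * 1ℚ                                 ≡⟨ ℚP.*-identityʳ d ⟩
    d                                      ∎
    where
    open ≡-Reasoning
    d : ℚ
    d = M p - N i p
    term : ∀ j → x j * Aᵖ p i j ≡ (d * w p) * (x j * N j p)
    term j = trans (cong (x j *_) (Aᵖ≡N*[M-N]*w p i j)) (rearrange (x j) (N j p) d (w p))
      where
      rearrange : ∀ a b c d → a * (b * c * d) ≡ (c * d) * (a * b)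
      rearrange = solve 4 (λ a b c d → a :* (b :* c :* d) := (c :* d) :* (a :* b)) refl
        where open +-*-Solver

  A*ᵥx≗x : (∀ p → 0 ℕ.< αp ns comp p) → A *ᵥ x ≗ x
  A*ᵥx≗x α>0 i = begin
    sumℚ (λ j → x j * sumℚ (λ p → Aᵖ p i j))  ≡⟨ sumℚ-cong (λ j → *-distribˡ-sumℚ (x j) (λ p → Aᵖ p i j)) ⟩
    sumℚ (λ j → sumℚ (λ p → x j * Aᵖ p i j))  ≡⟨ sumℚ-comm (λ j p → x j * Aᵖ p i j) ⟩
    sumℚ (λ p → sumℚ (λ j → x j * Aᵖ p i j))  ≡⟨ sumℚ-cong (λ p → x-weighted-Aᵖ (α>0 p) i) ⟩
    sumℚ (λ p → M p - N i p)                  ≡⟨ sumℚ-distrib-- M (N i) ⟩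
    sumℚ M - sumℚ (N i)                       ≡⟨ cong₂ _-_ sumℚ-M (sumℚ-N i) ⟩
    x i                                       ∎
    where open ≡-Reasoning

  N-nonneg : ∀ i p → 0ℚ ℚ.≤ N i p
  N-nonneg i p = toℚ-nonneg (nip ns comp i p)

  N-pos : ∀ i k → 0ℚ ℚ.< N i (comp (i , k))
  N-pos i k = ℚP.<-≤-trans (ℚP.positive⁻¹ 1ℚ) (begin
    1ℚ                                            ≡⟨ δ-diag (comp (i , k)) ⟨
    δ (comp (i , k)) (comp (i , k))               ≤⟨ ≤sumℚ (λ l → δ-nonneg (comp (i , l)) (comp (i , k))) k ⟩
    sumℚ (λ l → δ (comp (i , l)) (comp (i , k)))  ≡⟨ N≡sumℚ-δ i (comp (i , k)) ⟨
    N i (comp (i , k))                            ∎)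
    where open ℚP.≤-Reasoning

  x-pos : (∀ i → 1 ≤ ns i) → ∀ {i j} → j ≢ i → 0ℚ ℚ.< x i
  x-pos ns≥1 {i} {j} j≢i = ℚP.<-≤-trans (toℚ-pos (ns≥1 j)) (begin
    toℚ (ns j)                    ≤⟨ ≤sumℚ-minus (toℚ-nonneg ∘ ns) (j≢i ∘ sym) ⟩
    sumℚ (toℚ ∘ ns) - toℚ (ns i)  ≡⟨ cong (_- toℚ (ns i)) (toℚ-sumℕ ns) ⟨
    x i                           ∎)
    where open ℚP.≤-Reasoning

  α-pos : (∀ i → 0ℚ ℚ.< x i) → ∀ p → (∃ λ v → comp v ≡ p) → 0 ℕ.< αp ns comp p
  α-pos x>0 p ((i , k) , refl) = toℚ-pos⁻¹ (begin-strict
    0ℚ                        <⟨ *-pos (x>0 i) (N-pos i k) ⟩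
    x i * N i p               ≤⟨ ≤sumℚ (λ j → *-nonneg (ℚP.<⇒≤ (x>0 j)) (N-nonneg j p)) i ⟩
    sumℚ (λ j → x j * N j p)  ≡⟨ toℚ-α p ⟨
    toℚ (αp ns comp p)        ∎)
    where open ℚP.≤-Reasoning

  A-nonneg : ∀ i j → 0ℚ ℚ.≤ A i j
  A-nonneg i j = sumℚ-nonneg (λ p → divℕ-nonneg _ (αp ns comp p))

  A-pos : (∀ i → 1 ≤ ns i) → (∀ i → 0ℚ ℚ.< x i) → ∀ i j → i ≢ j → 0ℚ ℚ.< A i j
  A-pos ns≥1 x>0 i j i≢j = begin-strict
    0ℚ                           <⟨ *-pos (*-pos (N-pos j k) M-N>0) (divℕ1-pos (α-pos x>0 p (_ , refl))) ⟩
    N j p * (M p - N i p) * w p  ≡⟨ Aᵖ≡N*[M-N]*w p i j ⟨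
    Aᵖ p i j                     ≤⟨ ≤sumℚ (λ q → divℕ-nonneg _ (αp ns comp q)) p ⟩
    A i j                        ∎
    where
    open ℚP.≤-Reasoning
    k : Fin (ns j)
    k = Fin.fromℕ< (ns≥1 j)
    p : Fin c
    p = comp (j , k)
    M-N>0 : 0ℚ ℚ.< M p - N i p
    M-N>0 = ℚP.<-≤-trans (N-pos j k) (begin
      N j p                       ≤⟨ ≤sumℚ-minus (λ l → N-nonneg l p) i≢j ⟩
      sumℚ (λ l → N l p) - N i p  ≡⟨ cong (_- N i p) (M≡sumℚ-N p) ⟨
      M p - N i p                 ∎)

lemma4p1 : (s : ℕ) → 2 ≤ s → (ns : Fin s → ℕ) → (∀ i → 1 ≤ ns i) →
           (F : Vertex s ns → Vertex s ns → Set) → IsSpanningForest s ns F →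
           (c : ℕ) (comp : Vertex s ns → Fin c) → IsComponentLabelling F c comp →
           HasRank (Z0 ns comp) (s ∸ 1)
lemma4p1 (suc zero) (ℕ.s≤s ()) _ _ _ _ _ _ _
lemma4p1 (suc (suc s)) _ ns ns≥1 _ _ c comp (comp-onto , _) =
  hasRank-I- A x A-nonneg (A-pos ns≥1 x>0) x>0 (A*ᵥx≗x (λ p → α-pos x>0 p (comp-onto p)))
  where
  open Partition ns comp
  x>0 : ∀ i → 0ℚ ℚ.< x i
  x>0 i = x-pos ns≥1 (FinP.punchInᵢ≢i i zero)
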